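{- For every positive integer $n$, $Y_1(2,n)\ge n$.
   Context: A hypergraph $H$ on $[n]$ is a set of subsets (edges) of $[n]$; hypergraphs are assumed inclusion-free. For $w:[n]\to[M]$ and strictly increasing $f:[M]\to\mathbb{R}_{>0}$, let $fw(e)=\sum_{i\in e}f(w(i))$; $w$ is isolating for $H,f$ if exactly one edge of $H$ attains the minimum of $fw$ over $H$ (if $H$ has no edges, every $w$ is isolating). $Z_1(H,M,f)$ is the set of isolating $w\in[M]^n$ with $\min_x w(x)=1$, and $Y_1(M,n)=\min_{H,f}|Z_1(H,M,f)|$ over all hypergraphs $H$ on $[n]$ and all strictly increasing $f:[M]\to\mathbb{R}_{>0}$.
   Formalization: The strictly increasing functions $f$ take positive rational values instead of values in $\mathbb{R}_{>0}$. -}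

module Defs where

open import Data.Nat using (ℕ)
open import Data.Fin using (Fin; toℕ; _<_)
open import Data.Fin.Subset using (Subset; _⊆_)
open import Data.Bool using (if_then_else_)
open import Data.Vec using (Vec; lookup; allFin; foldr)
import Data.Vec as Vec
open import Data.Vec.Relation.Unary.Any as VAny using ()
open import Data.List using (List; [])
open import Data.List.Membership.Propositional using (_∈_)
open import Data.List.Relation.Unary.AllPairs using (AllPairs)
open import Data.Rational using (ℚ; 0ℚ; _+_; _≤_) renaming (_<_ to _<ℚ_)
open import Data.Product using (Σ; ∃; _×_)
open import Data.Sum using (_⊎_)
open import Relation.Nullary using (¬_)
open import Relation.Binary.PropositionalEquality using (_≡_)
open import Function.Definitions using (Injective)

-- [n] is modelled by Fin n; [M] = {1,…,M} by Fin M (Fin.zero ↦ 1, …).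
-- An edge is a subset of [n]; a hypergraph is a finite list of edges.
Hypergraph : ℕ → Set
Hypergraph n = List (Subset n)

-- Inclusion-free: for any two edges at distinct positions of the list, neither
-- is contained in the other (this also forces the list to be duplicate-free,
-- so the list faithfully represents a set of edges).
InclusionFree : ∀ {n} → Hypergraph n → Set
InclusionFree H = AllPairs (λ e e′ → ¬ (e ⊆ e′) × ¬ (e′ ⊆ e)) H

StrictlyIncreasing : ∀ {M} → (Fin M → ℚ) → Set
StrictlyIncreasing {M} f = ∀ {i j : Fin M} → i < j → f i <ℚ f j

Positive : ∀ {M} → (Fin M → ℚ) → Set
Positive f = ∀ i → 0ℚ <ℚ f i

fw : ∀ {n M} → (Fin M → ℚ) → Vec (Fin M) n → Subset n → ℚ
fw {n} f w e =
  foldr (λ _ → ℚ) _+_ 0ℚ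
    (Vec.map (λ i → if lookup e i then f (lookup w i) else 0ℚ) (allFin n))

AttainsMin : ∀ {n M} → Hypergraph n → (Fin M → ℚ) → Vec (Fin M) n → Subset n → Set
AttainsMin H f w e = e ∈ H × (∀ e′ → e′ ∈ H → fw f w e ≤ fw f w e′)

Isolating : ∀ {n M} → Hypergraph n → (Fin M → ℚ) → Vec (Fin M) n → Set
Isolating H f w =
  H ≡ [] ⊎
  (∃ λ e → AttainsMin H f w e × (∀ e′ → AttainsMin H f w e′ → e′ ≡ e))

-- min_x w(x) = 1, i.e. some coordinate takes the value 1 (toℕ v ≡ 0, as value 1 is encoded by index 0)
MinIsOne : ∀ {n M} → Vec (Fin M) n → Set
MinIsOne w = VAny.Any (λ v → toℕ v ≡ 0) w

InZ₁ : ∀ {n M} → Hypergraph n → (Fin M → ℚ) → Vec (Fin M) n → Set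
InZ₁ H f w = Isolating H f w × MinIsOne w

-- Y_1(M, n) ≥ k : for every inclusion-free H on [n] and every strictly
-- increasing positive f : [M] → ℚ, |Z_1(H,M,f)| ≥ k, i.e. there is an
-- injection from Fin k into Z_1(H,M,f).
Y₁-atLeast : ℕ → ℕ → ℕ → Set
Y₁-atLeast M n k =
  ∀ (H : Hypergraph n) → InclusionFree H →
  ∀ (f : Fin M → ℚ) → StrictlyIncreasing f → Positive f →
  Σ (Fin k → Vec (Fin M) n) λ g → Injective _≡_ _≡_ g × (∀ i → InZ₁ H f (g i))

{-# OPTIONS --safe #-}
module Submission where

-- A weight w ∈ {1,2}ⁿ is given by the set T = w⁻¹(1), nonempty since min w = 1, and with a = f(1) < b = f(2)
-- an edge e costs a·|e| + (b − a)·|e ∖ T|.  Hence T isolates an edge E once every other edge is at least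
-- as large as E and misses T at least as often, one of the two strictly.  If H is empty or ∅ ∈ H, all n
-- singletons are isolating.  Otherwise let K be the set of edges of minimum size k ≥ 1.  Every E ∈ K is
-- isolated by T = E, and by T = E △ {z} unless another member of K is adjacent to E △ {z} in the hypercube;
-- call z covered if this works for some E ∈ K with E △ {z} ≠ ∅.  One such E △ {z} per covered z gives
-- distinct isolating sets outside K, so it remains to show that at most |K| coordinates are uncovered.
-- For k = 1 each uncovered z gives the edge {z} ∈ K.  For k ≥ 2, for all t ∈ K and uncovered z the vertex
-- t △ {z} lies in K or next to a member of K other than t, and an induction on the dimension, projecting
-- away one coordinate at a time, shows that this forces |K| to be at least the number of such z.

open import Defs

open import Algebra.Bundles using (CommutativeMonoid)
open import Data.Bool using (not; if_then_else_)
import Data.Bool.Properties as Bool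
open import Data.Fin as Fin using (Fin; zero; suc; punchIn)
import Data.Fin.Properties as Fin
open import Data.Fin.Subset using (Subset; inside; outside; ∣_∣; _─_; _⊆_; ⊥; ⁅_⁆; Nonempty)
  renaming (_∈_ to _∈ₛ_; _∉_ to _∉ₛ_)
open import Data.Fin.Subset.Properties
  using (∣p∣≤n; ∣p─q∣≤∣p∣; ∉⊥; ∣⊥∣≡0; Empty-unique; nonempty?; x∈⁅x⁆; x∈⁅y⁆⇒x≡y; ⊆-refl)
  renaming (_∈?_ to _∈ₛ?_)
open import Data.List as List using (List; []; _∷_; length; map; filter; _++_)
open import Data.List.Membership.Propositional using (_∈_; _∉_; find; lose)
open import Data.List.Membership.Propositional.Properties
  using (∈-map⁺; ∈-map⁻; ∈-filter⁺; ∈-filter⁻; ∈-++⁻; ∈-length; ∈-lookup)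
open import Data.List.Properties using (length-map; length-++; length-tabulate; filter-notAll)
open import Data.List.Relation.Binary.Subset.Propositional using () renaming (_⊆_ to _⊆ˡ_)
import Data.List.Relation.Binary.Subset.Propositional.Properties as ⊆ˡ
open import Data.List.Relation.Unary.All as All using (All; []; _∷_)
import Data.List.Relation.Unary.All.Properties as All
open import Data.List.Relation.Unary.AllPairs as AllPairs using ([]; _∷_)
open import Data.List.Relation.Unary.Any as Any using (Any) renaming (here to here′; there to there′)
open import Data.List.Relation.Unary.Unique.Propositional using (Unique)
import Data.List.Relation.Unary.Unique.Propositional.Properties as Unique
open import Data.Nat as ℕ using (ℕ; zero; suc; _+_; _≤_; _<_; z≤n; s≤s)
open import Data.Nat.Properties
  using (+-suc; +-comm; +-identityʳ; +-cancelˡ-≡; +-cancelˡ-≤; +-monoˡ-≤; +-monoʳ-≤; m≤m+n; suc-injective;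
         m+1+n≢0; 1+n≢0; ≤-trans; ≤-reflexive; n≤1+n; n≤0⇒n≡0; ≤∧≢⇒<; <⇒≱; n≢0⇒n>0; n>0⇒n≢0;
         ≤-totalOrder; module ≤-Reasoning)
open import Data.List.Extrema ≤-totalOrder using (argmin; argmin-all; f[argmin]≤f[⊤]; f[argmin]≤f[xs])
open import Data.Product as Product using (Σ; ∃-syntax; _×_; _,_; proj₁; proj₂)
open import Data.Rational as ℚ using (ℚ; 0ℚ)
import Data.Rational.Properties as ℚ
open import Algebra.Definitions.RawMonoid ℚ.+-0-rawMonoid using () renaming (_×_ to _·_)
open import Algebra.Properties.CommutativeSemigroup
  (CommutativeMonoid.commutativeSemigroup ℚ.+-0-commutativeMonoid) using (interchange)
open import Data.Sum using (_⊎_; inj₁; inj₂)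
open import Data.Vec as Vec using (Vec; []; _∷_; lookup; tabulate; updateAt; removeAt; insertAt; here; there)
open import Data.Vec.Properties
  using (≡-dec; ∷-injectiveʳ; lookup∘updateAt; lookup∘updateAt′; updateAt-updateAt; updateAt-cong; updateAt-id;
         removeAt-punchOut; insertAt-removeAt; tabulate∘lookup; tabulate-cong; tabulate-∘; lookup∘tabulate;
         []=⇒lookup; lookup⇒[]=)
import Data.Vec.Relation.Unary.Any as VAny
open import Function using (_∘_; id)
open import Function.Definitions using (Injective)
open import Level using (0ℓ)
open import Relation.Binary.Definitions using (DecidableEquality)
open import Relation.Binary.PropositionalEquality
open import Relation.Nullary using (Dec; yes; no; does; ¬_; ¬?; contradiction)
open import Relation.Nullary.Decidable using (_×-dec_; _→-dec_)
open import Relation.Unary using (Pred; Decidable)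

private
  variable
    n M : ℕ
    A B : Set

_≟ˢ_ : DecidableEquality (Subset n)
_≟ˢ_ = ≡-dec Bool._≟_

lookup-extensional : ∀ {xs ys : Vec A n} → (∀ i → lookup xs i ≡ lookup ys i) → xs ≡ ys
lookup-extensional {xs = xs} {ys} eq =
  trans (sym (tabulate∘lookup xs)) (trans (tabulate-cong eq) (tabulate∘lookup ys))

lookup-removeAt : ∀ (xs : Vec A (suc n)) q x → lookup (removeAt xs q) x ≡ lookup xs (punchIn q x)
lookup-removeAt xs q x = trans (cong (lookup (removeAt xs q)) (sym (Fin.punchOut-punchIn q)))
                               (removeAt-punchOut xs (Fin.punchInᵢ≢i q x ∘ sym))

punchIn-view : ∀ (q x : Fin (suc n)) → x ≡ q ⊎ ∃[ x′ ] x ≡ punchIn q x′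
punchIn-view q x with q Fin.≟ x
... | yes q≡x = inj₁ (sym q≡x)
... | no q≢x = inj₂ (_ , sym (Fin.punchIn-punchOut q≢x))

toggle : Subset n → Fin n → Subset n
toggle p x = updateAt p x not

lookup-toggle : ∀ (p : Subset n) x → lookup (toggle p x) x ≡ not (lookup p x)
lookup-toggle p x = lookup∘updateAt x p

lookup-toggle′ : ∀ (p : Subset n) {x y} → y ≢ x → lookup (toggle p x) y ≡ lookup p y
lookup-toggle′ p {x} {y} y≢x = lookup∘updateAt′ y x y≢x p

toggle-involutive : ∀ (p : Subset n) x → toggle (toggle p x) x ≡ p
toggle-involutive p x =
  trans (updateAt-updateAt x p) (trans (updateAt-cong x Bool.not-involutive p) (updateAt-id x p))

toggle-≢ : ∀ (p : Subset n) x → toggle p x ≢ p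
toggle-≢ p x eq = Bool.not-¬ refl (trans (cong (λ s → lookup s x) (sym eq)) (lookup-toggle p x))

toggle²-≢ : ∀ (p : Subset n) {x y} → y ≢ x → toggle (toggle p x) y ≢ p
toggle²-≢ p {x} {y} y≢x eq = Bool.not-¬ refl (begin
  lookup p x                         ≡⟨ cong (λ s → lookup s x) eq ⟨
  lookup (toggle (toggle p x) y) x   ≡⟨ lookup-toggle′ (toggle p x) (y≢x ∘ sym) ⟩
  lookup (toggle p x) x              ≡⟨ lookup-toggle p x ⟩
  not (lookup p x)                   ∎)
  where open ≡-Reasoning

toggle-injective : ∀ (p : Subset n) {x y} → toggle p x ≡ toggle p y → x ≡ y
toggle-injective p {x} {y} eq with x Fin.≟ y
... | yes x≡y = x≡y
... | no x≢y = contradiction (trans (cong (λ s → toggle s x) (sym eq)) (toggle-involutive p x))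
                             (toggle²-≢ p x≢y)

∈-toggle : ∀ {p : Subset n} {x} → x ∉ₛ p → x ∈ₛ toggle p x
∈-toggle {p = p} {x} x∉p with lookup p x in eq
... | inside = contradiction (lookup⇒[]= x p eq) x∉p
... | outside = lookup⇒[]= x (toggle p x) (trans (lookup-toggle p x) (cong not eq))

∈-toggle′ : ∀ {p : Subset n} {x y} → y ≢ x → y ∈ₛ p → y ∈ₛ toggle p x
∈-toggle′ {p = p} {x} {y} y≢x y∈p = lookup⇒[]= y (toggle p x) (trans (lookup-toggle′ p y≢x) ([]=⇒lookup y∈p))

∣p─p∣≡0 : ∀ (p : Subset n) → ∣ p ─ p ∣ ≡ 0
∣p─p∣≡0 [] = refl
∣p─p∣≡0 (inside ∷ p) = ∣p─p∣≡0 p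
∣p─p∣≡0 (outside ∷ p) = ∣p─p∣≡0 p

∣p∣≡0⇒p≡⊥ : ∀ {p : Subset n} → ∣ p ∣ ≡ 0 → p ≡ ⊥
∣p∣≡0⇒p≡⊥ {p = []} _ = refl
∣p∣≡0⇒p≡⊥ {p = outside ∷ p} ∣p∣≡0 = cong (outside ∷_) (∣p∣≡0⇒p≡⊥ ∣p∣≡0)

∣p∣≢0⇒nonempty : ∀ {p : Subset n} → ∣ p ∣ ≢ 0 → Nonempty p
∣p∣≢0⇒nonempty {n} {p} ∣p∣≢0 with nonempty? p
... | yes p≢∅ = p≢∅
... | no p≡∅ = contradiction (trans (cong ∣_∣ (Empty-unique p≡∅)) (∣⊥∣≡0 n)) ∣p∣≢0

∣p∣≡1⇒p≡⁅x⁆ : ∀ {p : Subset n} {x} → x ∈ₛ p → ∣ p ∣ ≡ 1 → p ≡ ⁅ x ⁆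
∣p∣≡1⇒p≡⁅x⁆ here ∣p∣≡1 = cong (inside ∷_) (∣p∣≡0⇒p≡⊥ (suc-injective ∣p∣≡1))
∣p∣≡1⇒p≡⁅x⁆ {p = inside ∷ p} (there x∈p) ∣p∣≡1 =
  contradiction (subst (_ ∈ₛ_) (∣p∣≡0⇒p≡⊥ (suc-injective ∣p∣≡1)) x∈p) ∉⊥
∣p∣≡1⇒p≡⁅x⁆ {p = outside ∷ p} (there x∈p) ∣p∣≡1 = cong (outside ∷_) (∣p∣≡1⇒p≡⁅x⁆ x∈p ∣p∣≡1)

⁅⁆-injective : ∀ {x y : Fin n} → ⁅ x ⁆ ≡ ⁅ y ⁆ → x ≡ y
⁅⁆-injective {x = x} {y} eq = x∈⁅y⁆⇒x≡y y (subst (x ∈ₛ_) eq (x∈⁅x⁆ x))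

toggle-∉ : ∀ {p : Subset n} {x} → x ∉ₛ p → ∣ p ─ toggle p x ∣ ≡ 0 × ∣ toggle p x ∣ ≡ suc ∣ p ∣
toggle-∉ {p = inside ∷ p} {zero} x∉p = contradiction here x∉p
toggle-∉ {p = outside ∷ p} {zero} _ = ∣p─p∣≡0 p , refl
toggle-∉ {p = inside ∷ p} {suc x} x∉p = Product.map id (cong suc) (toggle-∉ (x∉p ∘ there))
toggle-∉ {p = outside ∷ p} {suc x} x∉p = toggle-∉ (x∉p ∘ there)

toggle-∈ : ∀ {p : Subset n} {x} → x ∈ₛ p → ∣ p ─ toggle p x ∣ ≡ 1 × ∣ p ∣ ≡ suc ∣ toggle p x ∣
toggle-∈ {p = inside ∷ p} here = cong suc (∣p─p∣≡0 p) , refl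
toggle-∈ {p = inside ∷ p} (there x∈p) = Product.map id (cong suc) (toggle-∈ x∈p)
toggle-∈ {p = outside ∷ p} (there x∈p) = toggle-∈ x∈p

toggle-nonempty : ∀ {p : Subset n} x → 2 ≤ ∣ p ∣ → Nonempty (toggle p x)
toggle-nonempty {p = p} x 2≤∣p∣ = ∣p∣≢0⇒nonempty ∣p′∣≢0
  where
  ∣p′∣≢0 : ∣ toggle p x ∣ ≢ 0
  ∣p′∣≢0 ∣p′∣≡0 with x ∈ₛ? p
  ... | yes x∈p = <⇒≱ 2≤∣p∣ (≤-reflexive (trans (proj₂ (toggle-∈ x∈p)) (cong suc ∣p′∣≡0)))
  ... | no x∉p = 1+n≢0 (trans (sym (proj₂ (toggle-∉ x∉p))) ∣p′∣≡0)

∣p∣+∣q─p∣≡∣q∣+∣p─q∣ : ∀ (p q : Subset n) → ∣ p ∣ + ∣ q ─ p ∣ ≡ ∣ q ∣ + ∣ p ─ q ∣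
∣p∣+∣q─p∣≡∣q∣+∣p─q∣ [] [] = refl
∣p∣+∣q─p∣≡∣q∣+∣p─q∣ (inside ∷ p) (inside ∷ q) = cong suc (∣p∣+∣q─p∣≡∣q∣+∣p─q∣ p q)
∣p∣+∣q─p∣≡∣q∣+∣p─q∣ (inside ∷ p) (outside ∷ q) =
  trans (cong suc (∣p∣+∣q─p∣≡∣q∣+∣p─q∣ p q)) (sym (+-suc ∣ q ∣ ∣ p ─ q ∣))
∣p∣+∣q─p∣≡∣q∣+∣p─q∣ (outside ∷ p) (inside ∷ q) =
  trans (+-suc ∣ p ∣ ∣ q ─ p ∣) (cong suc (∣p∣+∣q─p∣≡∣q∣+∣p─q∣ p q))
∣p∣+∣q─p∣≡∣q∣+∣p─q∣ (outside ∷ p) (outside ∷ q) = ∣p∣+∣q─p∣≡∣q∣+∣p─q∣ p q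

distance : Subset n → Subset n → ℕ
distance p q = ∣ p ─ q ∣ + ∣ q ─ p ∣

distance≡0⇒≡ : ∀ (p q : Subset n) → distance p q ≡ 0 → p ≡ q
distance≡0⇒≡ [] [] _ = refl
distance≡0⇒≡ (inside ∷ p) (inside ∷ q) d≡0 = cong (inside ∷_) (distance≡0⇒≡ p q d≡0)
distance≡0⇒≡ (outside ∷ p) (inside ∷ q) d≡0 = contradiction d≡0 (m+1+n≢0 ∣ p ─ q ∣)
distance≡0⇒≡ (outside ∷ p) (outside ∷ q) d≡0 = cong (outside ∷_) (distance≡0⇒≡ p q d≡0)

distance≡1⇒toggle : ∀ (p q : Subset n) → distance p q ≡ 1 → ∃[ y ] p ≡ toggle q y
distance≡1⇒toggle [] [] ()
distance≡1⇒toggle (inside ∷ p) (inside ∷ q) d≡1 with distance≡1⇒toggle p q d≡1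
... | y , p≡ = suc y , cong (inside ∷_) p≡
distance≡1⇒toggle (inside ∷ p) (outside ∷ q) d≡1 =
  zero , cong (inside ∷_) (distance≡0⇒≡ p q (suc-injective d≡1))
distance≡1⇒toggle (outside ∷ p) (inside ∷ q) d≡1 =
  zero , cong (outside ∷_) (distance≡0⇒≡ p q (suc-injective (trans (sym (+-suc ∣ p ─ q ∣ ∣ q ─ p ∣)) d≡1)))
distance≡1⇒toggle (outside ∷ p) (outside ∷ q) d≡1 with distance≡1⇒toggle p q d≡1
... | y , p≡ = suc y , cong (outside ∷_) p≡

∣p─q∣≡0⇒∣p∣≤∣q∣ : ∀ (p q : Subset n) → ∣ p ─ q ∣ ≡ 0 → ∣ p ∣ ≤ ∣ q ∣
∣p─q∣≡0⇒∣p∣≤∣q∣ p q ∣p─q∣≡0 = begin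
  ∣ p ∣                ≤⟨ m≤m+n ∣ p ∣ ∣ q ─ p ∣ ⟩
  ∣ p ∣ + ∣ q ─ p ∣    ≡⟨ ∣p∣+∣q─p∣≡∣q∣+∣p─q∣ p q ⟩
  ∣ q ∣ + ∣ p ─ q ∣    ≡⟨ cong (∣ q ∣ +_) ∣p─q∣≡0 ⟩
  ∣ q ∣ + 0            ≡⟨ +-identityʳ ∣ q ∣ ⟩
  ∣ q ∣                ∎
  where open ≤-Reasoning

∣p─q∣≡0∧∣q∣≤∣p∣⇒p≡q : ∀ (p q : Subset n) → ∣ p ─ q ∣ ≡ 0 → ∣ q ∣ ≤ ∣ p ∣ → p ≡ q
∣p─q∣≡0∧∣q∣≤∣p∣⇒p≡q p q ∣p─q∣≡0 ∣q∣≤∣p∣ =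
  distance≡0⇒≡ p q (trans (cong (_+ ∣ q ─ p ∣) ∣p─q∣≡0) (n≤0⇒n≡0 (+-cancelˡ-≤ ∣ p ∣ _ _ (begin
    ∣ p ∣ + ∣ q ─ p ∣    ≡⟨ ∣p∣+∣q─p∣≡∣q∣+∣p─q∣ p q ⟩
    ∣ q ∣ + ∣ p ─ q ∣    ≡⟨ cong (∣ q ∣ +_) ∣p─q∣≡0 ⟩
    ∣ q ∣ + 0            ≤⟨ +-monoˡ-≤ 0 ∣q∣≤∣p∣ ⟩
    ∣ p ∣ + 0            ∎))))
  where open ≤-Reasoning

∣p─q∣≡0∧∣q∣≡1+∣p∣⇒distance≡1 : ∀ (p q : Subset n) → ∣ p ─ q ∣ ≡ 0 → ∣ q ∣ ≡ suc ∣ p ∣ → distance p q ≡ 1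
∣p─q∣≡0∧∣q∣≡1+∣p∣⇒distance≡1 p q ∣p─q∣≡0 ∣q∣≡1+∣p∣ =
  trans (cong (_+ ∣ q ─ p ∣) ∣p─q∣≡0) (+-cancelˡ-≡ ∣ p ∣ _ _ (begin
    ∣ p ∣ + ∣ q ─ p ∣    ≡⟨ ∣p∣+∣q─p∣≡∣q∣+∣p─q∣ p q ⟩
    ∣ q ∣ + ∣ p ─ q ∣    ≡⟨ cong₂ _+_ ∣q∣≡1+∣p∣ ∣p─q∣≡0 ⟩
    suc ∣ p ∣ + 0        ≡⟨ cong suc (+-identityʳ ∣ p ∣) ⟩
    suc ∣ p ∣            ≡⟨ +-comm 1 ∣ p ∣ ⟩
    ∣ p ∣ + 1            ∎))
  where open ≡-Reasoning

∣p─q∣≡1∧∣p∣≡1+∣q∣⇒distance≡1 : ∀ (p q : Subset n) → ∣ p ─ q ∣ ≡ 1 → ∣ p ∣ ≡ suc ∣ q ∣ → distance p q ≡ 1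
∣p─q∣≡1∧∣p∣≡1+∣q∣⇒distance≡1 p q ∣p─q∣≡1 ∣p∣≡1+∣q∣ =
  trans (cong₂ _+_ ∣p─q∣≡1 (+-cancelˡ-≡ ∣ p ∣ _ _ (begin
    ∣ p ∣ + ∣ q ─ p ∣    ≡⟨ ∣p∣+∣q─p∣≡∣q∣+∣p─q∣ p q ⟩
    ∣ q ∣ + ∣ p ─ q ∣    ≡⟨ cong (∣ q ∣ +_) ∣p─q∣≡1 ⟩
    ∣ q ∣ + 1            ≡⟨ +-comm ∣ q ∣ 1 ⟩
    suc ∣ q ∣            ≡⟨ ∣p∣≡1+∣q∣ ⟨
    ∣ p ∣                ≡⟨ +-identityʳ ∣ p ∣ ⟨
    ∣ p ∣ + 0            ∎))) refl
  where open ≡-Reasoning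

removeAt-toggle : ∀ (p : Subset (suc n)) q → removeAt (toggle p q) q ≡ removeAt p q
removeAt-toggle p q = lookup-extensional λ x → begin
  lookup (removeAt (toggle p q) q) x   ≡⟨ lookup-removeAt (toggle p q) q x ⟩
  lookup (toggle p q) (punchIn q x)    ≡⟨ lookup-toggle′ p (Fin.punchInᵢ≢i q x) ⟩
  lookup p (punchIn q x)               ≡⟨ lookup-removeAt p q x ⟨
  lookup (removeAt p q) x              ∎
  where open ≡-Reasoning

removeAt-toggle-punchIn : ∀ (p : Subset (suc n)) q z →
                          removeAt (toggle p (punchIn q z)) q ≡ toggle (removeAt p q) z
removeAt-toggle-punchIn p q z = lookup-extensional λ x → begin
  lookup (removeAt (toggle p (punchIn q z)) q) x   ≡⟨ lookup-removeAt (toggle p (punchIn q z)) q x ⟩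
  lookup (toggle p (punchIn q z)) (punchIn q x)    ≡⟨ same-lookup x ⟩
  lookup (toggle (removeAt p q) z) x               ∎
  where
  open ≡-Reasoning
  same-lookup : ∀ x → lookup (toggle p (punchIn q z)) (punchIn q x) ≡ lookup (toggle (removeAt p q) z) x
  same-lookup x with x Fin.≟ z
  ... | yes refl = trans (lookup-toggle p (punchIn q x))
                         (sym (trans (lookup-toggle (removeAt p q) x) (cong not (lookup-removeAt p q x))))
  ... | no x≢z = trans (lookup-toggle′ p (x≢z ∘ Fin.punchIn-injective q x z))
                       (sym (trans (lookup-toggle′ (removeAt p q) x≢z) (lookup-removeAt p q x)))

removeAt-toggle-toggle : ∀ (p : Subset (suc n)) q y →
                         removeAt (toggle (toggle p q) (punchIn q y)) q ≡ toggle (removeAt p q) y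
removeAt-toggle-toggle p q y =
  trans (removeAt-toggle-punchIn (toggle p q) q y) (cong (λ s → toggle s y) (removeAt-toggle p q))

∈-removeAt⁺ : ∀ {p : Subset (suc n)} {q x} → punchIn q x ∈ₛ p → x ∈ₛ removeAt p q
∈-removeAt⁺ {p = p} {q} {x} x∈p =
  lookup⇒[]= x (removeAt p q) (trans (lookup-removeAt p q x) ([]=⇒lookup x∈p))

∈-removeAt⁻ : ∀ {p : Subset (suc n)} {q x} → x ∈ₛ removeAt p q → punchIn q x ∈ₛ p
∈-removeAt⁻ {p = p} {q} {x} x∈p =
  lookup⇒[]= (punchIn q x) p (trans (sym (lookup-removeAt p q x)) ([]=⇒lookup x∈p))

∣insertAt∣ : ∀ (p : Subset n) q b → ∣ insertAt p q b ∣ ≡ ∣ b ∷ p ∣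
∣insertAt∣ p zero b = refl
∣insertAt∣ (inside ∷ p) (suc q) inside = cong suc (∣insertAt∣ p q inside)
∣insertAt∣ (inside ∷ p) (suc q) outside = cong suc (∣insertAt∣ p q outside)
∣insertAt∣ (outside ∷ p) (suc q) b = ∣insertAt∣ p q b

∣removeAt∣ : ∀ (p : Subset (suc n)) q → ∣ lookup p q ∷ removeAt p q ∣ ≡ ∣ p ∣
∣removeAt∣ p q = trans (sym (∣insertAt∣ (removeAt p q) q (lookup p q))) (cong ∣_∣ (insertAt-removeAt p q))

∣removeAt∣-∈ : ∀ {p : Subset (suc n)} {q} → q ∈ₛ p → suc ∣ removeAt p q ∣ ≡ ∣ p ∣
∣removeAt∣-∈ {p = p} {q} q∈p =
  trans (cong (λ b → ∣ b ∷ removeAt p q ∣) (sym ([]=⇒lookup q∈p))) (∣removeAt∣ p q)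

∣removeAt∣-∉ : ∀ {p : Subset (suc n)} {q} → q ∉ₛ p → ∣ removeAt p q ∣ ≡ ∣ p ∣
∣removeAt∣-∉ {p = p} {q} q∉p with lookup p q in eq
... | inside = contradiction (lookup⇒[]= q p eq) q∉p
... | outside = trans (cong (λ b → ∣ b ∷ removeAt p q ∣) (sym eq)) (∣removeAt∣ p q)

module Removal {A : Set} (_≟_ : DecidableEquality A) where

  _∖_ : List A → A → List A
  xs ∖ x = filter (λ y → ¬? (y ≟ x)) xs

  ∈-∖⁺ : ∀ {x y xs} → y ∈ xs → y ≢ x → y ∈ xs ∖ x
  ∈-∖⁺ {x} = ∈-filter⁺ (λ y → ¬? (y ≟ x))

  ∈-∖⁻ : ∀ {x y xs} → y ∈ xs ∖ x → y ∈ xs × y ≢ x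
  ∈-∖⁻ {x} = ∈-filter⁻ (λ y → ¬? (y ≟ x))

  ∖-⊆ : ∀ {x} xs → xs ∖ x ⊆ˡ xs
  ∖-⊆ xs = proj₁ ∘ ∈-∖⁻

  length-∖ : ∀ {x xs} → x ∈ xs → length (xs ∖ x) < length xs
  length-∖ {x} {xs} x∈xs = filter-notAll (λ y → ¬? (y ≟ x)) xs (Any.map (λ y≡x y≢x → y≢x (sym y≡x)) x∈xs)

  unique-⊆⇒length≤ : ∀ {xs ys} → Unique xs → xs ⊆ˡ ys → length xs ≤ length ys
  unique-⊆⇒length≤ {[]} _ _ = z≤n
  unique-⊆⇒length≤ {x ∷ xs} {ys} (x∉xs ∷ unique) x∷xs⊆ys =
    ≤-trans (s≤s (unique-⊆⇒length≤ unique xs⊆ys∖x)) (length-∖ (x∷xs⊆ys (here′ refl)))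
    where
    xs⊆ys∖x : xs ⊆ˡ ys ∖ x
    xs⊆ys∖x y∈xs = ∈-∖⁺ (x∷xs⊆ys (there′ y∈xs)) (All.lookup x∉xs y∈xs ∘ sym)

module _ {n : ℕ} where
  open Removal (_≟ˢ_ {n}) public
  open import Data.List.Membership.DecPropositional (_≟ˢ_ {n}) public using (_∈?_)

length-filter+length-filter¬ : ∀ {P : Pred A 0ℓ} (P? : Decidable P) xs →
                                length (filter P? xs) + length (filter (¬? ∘ P?) xs) ≡ length xs
length-filter+length-filter¬ P? [] = refl
length-filter+length-filter¬ P? (x ∷ xs) with P? x
... | yes _ = cong suc (length-filter+length-filter¬ P? xs)
... | no _ = trans (+-suc _ _) (cong suc (length-filter+length-filter¬ P? xs))

∣tabulate∣≡length-filter : ∀ {m} {P : Pred A 0ℓ} (P? : Decidable P) (h : Fin m → A) →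
                           ∣ tabulate (does ∘ P? ∘ h) ∣ ≡ length (filter P? (List.tabulate h))
∣tabulate∣≡length-filter {m = zero} P? h = refl
∣tabulate∣≡length-filter {m = suc m} P? h with P? (h zero)
... | yes _ = cong suc (∣tabulate∣≡length-filter P? (h ∘ suc))
... | no _ = ∣tabulate∣≡length-filter P? (h ∘ suc)

unique-lookup-injective : ∀ {xs : List A} → Unique xs →
                          ∀ i j → List.lookup xs i ≡ List.lookup xs j → i ≡ j
unique-lookup-injective (_ ∷ _) zero zero _ = refl
unique-lookup-injective (x∉xs ∷ _) zero (suc j) eq = contradiction eq (All.lookup x∉xs (∈-lookup j))
unique-lookup-injective (x∉xs ∷ _) (suc i) zero eq = contradiction (sym eq) (All.lookup x∉xs (∈-lookup i))
unique-lookup-injective (_ ∷ unique) (suc i) (suc j) eq = cong suc (unique-lookup-injective unique i j eq)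

unique-map⁺ : ∀ {P : Pred A 0ℓ} {f : A → B} {xs} → All P xs →
              (∀ {x y} → P x → P y → f x ≡ f y → x ≡ y) → Unique xs → Unique (List.map f xs)
unique-map⁺ [] _ [] = []
unique-map⁺ (px ∷ pxs) injective (x∉xs ∷ unique) =
  All.map⁺ (All.zipWith (λ (x≢y , py) fx≡fy → x≢y (injective px py fx≡fy)) (x∉xs , pxs))
  ∷ unique-map⁺ pxs injective unique

-- Sets of vertices of the hypercube

project : Fin (suc n) → List (Subset (suc n)) → List (Subset n)
project q = map (λ t → removeAt t q)

project⁺ : ∀ {τ} {t : Subset (suc n)} {s} q → t ∈ τ → removeAt t q ≡ s → s ∈ project q τ
project⁺ q t∈τ refl = ∈-map⁺ (λ t → removeAt t q) t∈τ

project-∖ : ∀ {τ} {w : Subset (suc n)} q → toggle w q ∈ τ → project q τ ⊆ˡ project q (τ ∖ w)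
project-∖ {w = w} q w′∈τ s∈ with ∈-map⁻ _ s∈
... | t , t∈τ , refl with t ≟ˢ w
...   | yes refl = project⁺ q (∈-∖⁺ w′∈τ (toggle-≢ t q)) (removeAt-toggle t q)
...   | no t≢w = project⁺ q (∈-∖⁺ t∈τ t≢w) refl

Dominated : List (Subset n) → Fin n → Subset n → Set
Dominated τ x s = s ∈ τ ⊎ ∃[ y ] (y ≢ x × toggle s y ∈ τ)

-- Excluding the direction x means that t itself never witnesses Dominated τ x (toggle t x).
Dense : Subset n → List (Subset n) → Set
Dense β τ = ∀ {t} → t ∈ τ → ∀ {x} → x ∈ₛ β → Dominated τ x (toggle t x)

HasEdge : Subset n → List (Subset n) → Set
HasEdge β τ = Any (λ t → ∃[ x ] (x ∈ₛ β × toggle t x ∈ τ)) τ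

hasEdge? : ∀ (β : Subset n) τ → Dec (HasEdge β τ)
hasEdge? β τ = Any.any? (λ t → Fin.any? (λ x → (x ∈ₛ? β) ×-dec (toggle t x ∈? τ))) τ

hasEdge-mono : ∀ {β : Subset n} {σ τ} → σ ⊆ˡ τ → HasEdge β σ → HasEdge β τ
hasEdge-mono σ⊆τ edge with find edge
... | s , s∈σ , x , x∈β , s′∈σ = lose (σ⊆τ s∈σ) (x , x∈β , σ⊆τ s′∈σ)

hasEdge-project : ∀ {β : Subset n} {τ} {t u : Subset (suc n)} {x} q → t ∈ τ → u ∈ τ → x ∈ₛ β →
                  removeAt u q ≡ toggle (removeAt t q) x → HasEdge β (project q τ)
hasEdge-project q t∈τ u∈τ x∈β u≡ = lose (project⁺ q t∈τ refl) (_ , x∈β , project⁺ q u∈τ u≡)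

dense-project : ∀ {β : Subset (suc n)} {τ σ} q → Dense β τ →
                σ ⊆ˡ project q τ → project q τ ⊆ˡ σ → Dense (removeAt β q) σ
dense-project q dense σ⊆ ⊆σ s∈σ {z} z∈β′ with ∈-map⁻ _ (σ⊆ s∈σ)
... | t , t∈τ , refl with dense t∈τ (∈-removeAt⁻ z∈β′)
...   | inj₁ u∈τ = inj₁ (⊆σ (project⁺ q u∈τ (removeAt-toggle-punchIn t q z)))
...   | inj₂ (y , y≢ , u∈τ) with punchIn-view q y
...     | inj₁ refl = inj₁ (⊆σ (project⁺ q u∈τ (begin
  removeAt (toggle (toggle t (punchIn q z)) q) q   ≡⟨ removeAt-toggle (toggle t (punchIn q z)) q ⟩
  removeAt (toggle t (punchIn q z)) q              ≡⟨ removeAt-toggle-punchIn t q z ⟩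
  toggle (removeAt t q) z                          ∎)))
  where open ≡-Reasoning
...     | inj₂ (y′ , refl) = inj₂ (y′ , y≢ ∘ cong (punchIn q) , ⊆σ (project⁺ q u∈τ (begin
  removeAt (toggle (toggle t (punchIn q z)) (punchIn q y′)) q
    ≡⟨ removeAt-toggle-punchIn (toggle t (punchIn q z)) q y′ ⟩
  toggle (removeAt (toggle t (punchIn q z)) q) y′
    ≡⟨ cong (λ s → toggle s y′) (removeAt-toggle-punchIn t q z) ⟩
  toggle (toggle (removeAt t q) z) y′
    ∎)))
  where open ≡-Reasoning

Bounds : Subset n → List (Subset n) → Set
Bounds β τ = ∣ β ∣ ≤ length τ × (HasEdge β τ → suc ∣ β ∣ ≤ length τ)

DenseBound : ℕ → Set
DenseBound n = ∀ (β : Subset n) τ {t} → t ∈ τ → Dense β τ → Bounds β τ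

toggle-or-projectedEdge : ∀ {β : Subset (suc n)} {τ t} q → (∀ x → x ∈ₛ β) → Dense β τ → t ∈ τ →
                          toggle t q ∈ τ ⊎ HasEdge (removeAt β q) (project q τ)
toggle-or-projectedEdge {t = t} q full dense t∈τ with dense t∈τ (full q)
... | inj₁ t′∈τ = inj₁ t′∈τ
... | inj₂ (y , y≢q , u∈τ) with punchIn-view q y
...   | inj₁ refl = contradiction refl y≢q
...   | inj₂ (y′ , refl) =
  inj₂ (hasEdge-project q t∈τ u∈τ (∈-removeAt⁺ (full _)) (removeAt-toggle-toggle t q y′))

bound-∉ : DenseBound n → ∀ (β : Subset (suc n)) τ {t q} → q ∉ₛ β → t ∈ τ → Dense β τ → Bounds β τ
bound-∉ ih β τ {q = q} q∉β t∈τ dense =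
  subst₂ _≤_ ∣β′∣≡∣β∣ length≡ (proj₁ bounds) ,
  λ edge → subst₂ _≤_ (cong suc ∣β′∣≡∣β∣) length≡ (proj₂ bounds (projectedEdge edge))
  where
  bounds : Bounds (removeAt β q) (project q τ)
  bounds = ih (removeAt β q) (project q τ) (project⁺ q t∈τ refl) (dense-project q dense id id)
  ∣β′∣≡∣β∣ : ∣ removeAt β q ∣ ≡ ∣ β ∣
  ∣β′∣≡∣β∣ = ∣removeAt∣-∉ q∉β
  length≡ : length (project q τ) ≡ length τ
  length≡ = length-map _ τ
  projectedEdge : HasEdge β τ → HasEdge (removeAt β q) (project q τ)
  projectedEdge edge with find edge
  ... | t , t∈τ , x , x∈β , u∈τ with punchIn-view q x
  ...   | inj₁ refl = contradiction x∈β q∉β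
  ...   | inj₂ (x′ , refl) = hasEdge-project q t∈τ u∈τ (∈-removeAt⁺ x∈β) (removeAt-toggle-punchIn t q x′)

toggle-closed : ∀ {β : Subset (suc n)} {τ} q → (∀ x → x ∈ₛ β) → Dense β τ →
                ¬ HasEdge (removeAt β q) (project q τ) → ∀ {t} → t ∈ τ → toggle t q ∈ τ
toggle-closed q full dense ¬edge t∈τ with toggle-or-projectedEdge q full dense t∈τ
... | inj₁ t′∈τ = t′∈τ
... | inj₂ edge = contradiction edge ¬edge

-- Here τ is closed under toggling q, so deleting t₁ and a second vertex t₂ with another projection leaves
-- the projection along q unchanged; t₂ exists because the projection is dense but has no edge.
bound-closed : DenseBound n → ∀ (β : Subset (suc n)) τ {t₁} q → (∀ x → x ∈ₛ β) → Dense β τ → t₁ ∈ τ →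
               ¬ HasEdge (removeAt β q) (project q τ) → suc ∣ β ∣ ≤ length τ
bound-closed {zero} ih β τ {t₁} q full dense t₁∈τ ¬edge = begin
  suc ∣ β ∣                       ≡⟨ cong suc (∣removeAt∣-∈ (full q)) ⟨
  2 + ∣ removeAt β q ∣            ≡⟨ cong (2 +_) (n≤0⇒n≡0 (∣p∣≤n (removeAt β q))) ⟩
  2                               ≤⟨ s≤s (∈-length t₁′∈τ∖t₁) ⟩
  suc (length (τ ∖ t₁))           ≤⟨ length-∖ t₁∈τ ⟩
  length τ                        ∎
  where
  open ≤-Reasoning
  t₁′∈τ∖t₁ : toggle t₁ q ∈ τ ∖ t₁
  t₁′∈τ∖t₁ = ∈-∖⁺ (toggle-closed q full dense ¬edge t₁∈τ) (toggle-≢ t₁ q)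
bound-closed {suc n} ih β τ {t₁} q full dense t₁∈τ ¬edge
  with dense-project q dense id id (project⁺ q t₁∈τ refl) (∈-removeAt⁺ (full (punchIn q zero)))
... | inj₁ s₁′∈π = contradiction (lose (project⁺ q t₁∈τ refl) (zero , ∈-removeAt⁺ (full _) , s₁′∈π)) ¬edge
... | inj₂ (y , y≢0 , s₂∈π) with ∈-map⁻ _ s₂∈π
...   | t₂ , t₂∈τ , s₂≡ = begin
  suc ∣ β ∣                          ≡⟨ cong suc (∣removeAt∣-∈ (full q)) ⟨
  2 + ∣ removeAt β q ∣               ≤⟨ s≤s (s≤s weak) ⟩
  2 + length (project q τ₂)          ≡⟨ cong (2 +_) (length-map _ τ₂) ⟩
  2 + length τ₂                      ≤⟨ s≤s (length-∖ t₂∈τ∖t₁) ⟩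
  suc (length (τ ∖ t₁))              ≤⟨ length-∖ t₁∈τ ⟩
  length τ                           ∎
  where
  open ≤-Reasoning
  closed : ∀ {t} → t ∈ τ → toggle t q ∈ τ
  closed = toggle-closed q full dense ¬edge
  apart : ∀ {u} → removeAt u q ≡ removeAt t₂ q → u ≢ t₁
  apart u≡ refl = toggle²-≢ (removeAt t₁ q) y≢0 (trans s₂≡ (sym u≡))
  τ₂ : List (Subset (suc (suc n)))
  τ₂ = (τ ∖ t₁) ∖ t₂
  t₂∈τ∖t₁ : t₂ ∈ τ ∖ t₁
  t₂∈τ∖t₁ = ∈-∖⁺ t₂∈τ (apart refl)
  π⊆π₂ : project q τ ⊆ˡ project q τ₂
  π⊆π₂ = project-∖ q (∈-∖⁺ (closed t₂∈τ) (apart (removeAt-toggle t₂ q)))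
       ∘ project-∖ q (closed t₁∈τ)
  weak : ∣ removeAt β q ∣ ≤ length (project q τ₂)
  weak = proj₁ (ih (removeAt β q) (project q τ₂) (π⊆π₂ (project⁺ q t₁∈τ refl))
                   (dense-project q dense (⊆ˡ.map⁺ _ (∖-⊆ τ ∘ ∖-⊆ (τ ∖ t₁))) π⊆π₂))

bound-edge : DenseBound n → ∀ (β : Subset (suc n)) τ → (∀ x → x ∈ₛ β) → Dense β τ →
             HasEdge β τ → suc ∣ β ∣ ≤ length τ
bound-edge ih β τ full dense edge with find edge
... | t₁ , t₁∈τ , q , _ , t₁′∈τ with hasEdge? (removeAt β q) (project q τ)
...   | no ¬edge = bound-closed ih β τ q full dense t₁∈τ ¬edge
...   | yes edge′ = begin
  suc ∣ β ∣                          ≡⟨ cong suc (∣removeAt∣-∈ (full q)) ⟨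
  2 + ∣ removeAt β q ∣               ≤⟨ s≤s strong ⟩
  suc (length (project q (τ ∖ t₁)))  ≡⟨ cong suc (length-map _ (τ ∖ t₁)) ⟩
  suc (length (τ ∖ t₁))              ≤⟨ length-∖ t₁∈τ ⟩
  length τ                           ∎
  where
  open ≤-Reasoning
  π⊆π₁ : project q τ ⊆ˡ project q (τ ∖ t₁)
  π⊆π₁ = project-∖ q t₁′∈τ
  strong : suc ∣ removeAt β q ∣ ≤ length (project q (τ ∖ t₁))
  strong = proj₂ (ih (removeAt β q) (project q (τ ∖ t₁)) (π⊆π₁ (project⁺ q t₁∈τ refl))
                     (dense-project q dense (⊆ˡ.map⁺ _ (∖-⊆ τ)) π⊆π₁))
                 (hasEdge-mono π⊆π₁ edge′)

bound-full : DenseBound n → ∀ (β : Subset (suc n)) τ {t} → (∀ x → x ∈ₛ β) → t ∈ τ → Dense β τ → Bounds β τ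
bound-full ih β τ full t∈τ dense with hasEdge? β τ
... | yes edge = ≤-trans (n≤1+n _) strong , λ _ → strong
  where
  strong : suc ∣ β ∣ ≤ length τ
  strong = bound-edge ih β τ full dense edge
... | no ¬edge = subst₂ _≤_ (∣removeAt∣-∈ (full zero)) (length-map _ τ) strong , λ edge → contradiction edge ¬edge
  where
  projectedEdge : HasEdge (removeAt β zero) (project zero τ)
  projectedEdge with toggle-or-projectedEdge zero full dense t∈τ
  ... | inj₁ t′∈τ = contradiction (lose t∈τ (zero , full zero , t′∈τ)) ¬edge
  ... | inj₂ edge′ = edge′
  strong : suc ∣ removeAt β zero ∣ ≤ length (project zero τ)
  strong = proj₂ (ih (removeAt β zero) (project zero τ) (project⁺ zero t∈τ refl)
                     (dense-project zero dense id id))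
                 projectedEdge

denseBound : ∀ n → DenseBound n
denseBound zero [] τ t∈τ dense = z≤n , λ _ → ∈-length t∈τ
denseBound (suc n) β τ t∈τ dense with Fin.all? (_∈ₛ? β)
... | yes full = bound-full (denseBound n) β τ full t∈τ dense
... | no ¬full = bound-∉ (denseBound n) β τ (proj₂ (Fin.¬∀⟶∃¬ _ _ (_∈ₛ? β) ¬full)) t∈τ dense

dense⇒∣β∣≤length : ∀ {β : Subset n} {τ t} → t ∈ τ → Dense β τ → ∣ β ∣ ≤ length τ
dense⇒∣β∣≤length {β = β} {τ} t∈τ dense = proj₁ (denseBound _ β τ t∈τ dense)

-- Weights with two values

·-nonNeg : ∀ {x} k → 0ℚ ℚ.≤ x → 0ℚ ℚ.≤ k · x
·-nonNeg zero 0≤x = ℚ.≤-refl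
·-nonNeg (suc k) 0≤x = ℚ.+-mono-≤ 0≤x (·-nonNeg k 0≤x)

·-monoˡ-≤ : ∀ {x j k} → 0ℚ ℚ.≤ x → j ≤ k → j · x ℚ.≤ k · x
·-monoˡ-≤ {k = k} 0≤x z≤n = ·-nonNeg k 0≤x
·-monoˡ-≤ {x} 0≤x (s≤s j≤k) = ℚ.+-monoʳ-≤ x (·-monoˡ-≤ 0≤x j≤k)

·-monoˡ-< : ∀ {x j k} → 0ℚ ℚ.< x → j < k → j · x ℚ.< k · x
·-monoˡ-< {k = suc k} 0<x (s≤s z≤n) = ℚ.+-mono-<-≤ 0<x (·-nonNeg k (ℚ.<⇒≤ 0<x))
·-monoˡ-< {x} 0<x (s≤s (s≤s j<k)) = ℚ.+-monoʳ-< x (·-monoˡ-< 0<x (s≤s j<k))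

weighted-< : ∀ {a c s s′ r r′} → 0ℚ ℚ.< a → 0ℚ ℚ.< c → s ≤ s′ → r ≤ r′ → s < s′ ⊎ r < r′ →
             s · a ℚ.+ r · c ℚ.< s′ · a ℚ.+ r′ · c
weighted-< 0<a 0<c s≤s′ r≤r′ (inj₁ s<s′) = ℚ.+-mono-<-≤ (·-monoˡ-< 0<a s<s′) (·-monoˡ-≤ (ℚ.<⇒≤ 0<c) r≤r′)
weighted-< 0<a 0<c s≤s′ r≤r′ (inj₂ r<r′) = ℚ.+-mono-≤-< (·-monoˡ-≤ (ℚ.<⇒≤ 0<a) s≤s′) (·-monoˡ-< 0<c r<r′)

fw-∷ : ∀ (f : Fin M → ℚ) w (ws : Vec (Fin M) n) b e →
       fw f (w ∷ ws) (b ∷ e) ≡ (if b then f w else 0ℚ) ℚ.+ fw f ws e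
fw-∷ {n = n} f w ws b e =
  cong (λ v → (if b then f w else 0ℚ) ℚ.+ Vec.foldr _ ℚ._+_ 0ℚ v)
       (trans (sym (tabulate-∘ summand suc)) (tabulate-∘ summand′ id))
  where
  summand : Fin (suc n) → ℚ
  summand i = if Vec.lookup (b ∷ e) i then f (Vec.lookup (w ∷ ws) i) else 0ℚ
  summand′ : Fin n → ℚ
  summand′ i = if Vec.lookup e i then f (Vec.lookup ws i) else 0ℚ

-- T ⊆ [n] stands for the weight w ∈ [2]^n with w(x) = 1 on T and 2 off T; Fin 2 lists the values from 1.
weight : Subset n → Vec (Fin 2) n
weight = Vec.map (λ b → if b then zero else suc zero)

weight-injective : ∀ (T U : Subset n) → weight T ≡ weight U → T ≡ U
weight-injective [] [] _ = refl
weight-injective (inside ∷ T) (inside ∷ U) eq = cong (inside ∷_) (weight-injective T U (∷-injectiveʳ eq))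
weight-injective (outside ∷ T) (outside ∷ U) eq = cong (outside ∷_) (weight-injective T U (∷-injectiveʳ eq))

nonempty⇒minIsOne : ∀ {T : Subset n} → Nonempty T → MinIsOne (weight T)
nonempty⇒minIsOne (zero , here) = VAny.here refl
nonempty⇒minIsOne (suc x , there x∈T) = VAny.there (nonempty⇒minIsOne (x , x∈T))

module TwoValueCosts (f : Fin 2 → ℚ) (0<a : 0ℚ ℚ.< f zero) (a<b : f zero ℚ.< f (suc zero)) where

  a c : ℚ
  a = f zero
  c = f (suc zero) ℚ.- a

  b≡a+c : f (suc zero) ≡ a ℚ.+ c
  b≡a+c = begin
    f (suc zero)                    ≡⟨ ℚ.+-identityˡ _ ⟨
    0ℚ ℚ.+ f (suc zero)             ≡⟨ cong (ℚ._+ f (suc zero)) (ℚ.+-inverseʳ a) ⟨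
    (a ℚ.- a) ℚ.+ f (suc zero)      ≡⟨ ℚ.+-assoc a (ℚ.- a) (f (suc zero)) ⟩
    a ℚ.+ (ℚ.- a ℚ.+ f (suc zero))  ≡⟨ cong (a ℚ.+_) (ℚ.+-comm (ℚ.- a) (f (suc zero))) ⟩
    a ℚ.+ c                         ∎
    where open ≡-Reasoning

  0<c : 0ℚ ℚ.< c
  0<c = subst (ℚ._< c) (ℚ.+-inverseʳ a) (ℚ.+-monoˡ-< (ℚ.- a) a<b)

  fw-weight : ∀ (T e : Subset n) → fw f (weight T) e ≡ ∣ e ∣ · a ℚ.+ ∣ e ─ T ∣ · c
  fw-weight [] [] = refl
  fw-weight (inside ∷ T) (inside ∷ e) = trans (fw-∷ f zero (weight T) inside e)
    (trans (cong (a ℚ.+_) (fw-weight T e)) (sym (ℚ.+-assoc a (∣ e ∣ · a) (∣ e ─ T ∣ · c))))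
  fw-weight (outside ∷ T) (inside ∷ e) = trans (fw-∷ f (suc zero) (weight T) inside e)
    (trans (cong₂ ℚ._+_ b≡a+c (fw-weight T e)) (interchange a c (∣ e ∣ · a) (∣ e ─ T ∣ · c)))
  fw-weight (inside ∷ T) (outside ∷ e) = trans (fw-∷ f zero (weight T) outside e)
    (trans (ℚ.+-identityˡ _) (fw-weight T e))
  fw-weight (outside ∷ T) (outside ∷ e) = trans (fw-∷ f (suc zero) (weight T) outside e)
    (trans (ℚ.+-identityˡ _) (fw-weight T e))

  fw-weight-< : ∀ (T E e : Subset n) → ∣ E ∣ ≤ ∣ e ∣ → ∣ E ─ T ∣ ≤ ∣ e ─ T ∣ →
                ∣ E ∣ < ∣ e ∣ ⊎ ∣ E ─ T ∣ < ∣ e ─ T ∣ → fw f (weight T) E ℚ.< fw f (weight T) e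
  fw-weight-< T E e ∣E∣≤ ∣E─T∣≤ strict =
    subst₂ ℚ._<_ (sym (fw-weight T E)) (sym (fw-weight T e)) (weighted-< 0<a 0<c ∣E∣≤ ∣E─T∣≤ strict)

UniqueMinimiser : Hypergraph n → (Fin M → ℚ) → Vec (Fin M) n → Subset n → Set
UniqueMinimiser H f w E = E ∈ H × (∀ {e} → e ∈ H → e ≢ E → fw f w E ℚ.< fw f w e)

module _ {H : Hypergraph n} {f : Fin M → ℚ} {w : Vec (Fin M) n} where

  uniqueMinimiser⇒isolating : ∀ {E} → UniqueMinimiser H f w E → Isolating H f w
  uniqueMinimiser⇒isolating {E} (E∈H , E<) = inj₂ (E , (E∈H , minimum) , unique)
    where
    minimum : ∀ e → e ∈ H → fw f w E ℚ.≤ fw f w e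
    minimum e e∈H with e ≟ˢ E
    ... | yes refl = ℚ.≤-refl
    ... | no e≢E = ℚ.<⇒≤ (E< e∈H e≢E)
    unique : ∀ e → AttainsMin H f w e → e ≡ E
    unique e (e∈H , e≤) with e ≟ˢ E
    ... | yes e≡E = e≡E
    ... | no e≢E = contradiction (ℚ.<-≤-trans (E< e∈H e≢E) (e≤ E E∈H)) (ℚ.<-irrefl refl)

  uniqueMinimiser-unique : ∀ {E E′} → UniqueMinimiser H f w E → UniqueMinimiser H f w E′ → E ≡ E′
  uniqueMinimiser-unique {E} {E′} (E∈H , E<) (E′∈H , E′<) with E ≟ˢ E′
  ... | yes E≡E′ = E≡E′
  ... | no E≢E′ = contradiction (E< E′∈H (E≢E′ ∘ sym)) (ℚ.<-asym (E′< E∈H E≢E′))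

Z₁-Embedding : ℕ → Hypergraph n → (Fin 2 → ℚ) → Set
Z₁-Embedding {n} k H f = Σ (Fin k → Vec (Fin 2) n) λ g → Injective _≡_ _≡_ g × (∀ i → InZ₁ H f (g i))

Z₁-embedding : ∀ (H : Hypergraph n) f {k} (L : List (Subset n)) → Unique L → k ≤ length L →
               (∀ {T} → T ∈ L → Isolating H f (weight T) × Nonempty T) → Z₁-Embedding k H f
Z₁-embedding {n} H f L unique k≤|L| good =
  g , g-injective , λ i → Product.map₂ nonempty⇒minIsOne (good (∈-lookup (index i)))
  where
  index : Fin _ → Fin (length L)
  index i = Fin.inject≤ i k≤|L|
  g : Fin _ → Vec (Fin 2) n
  g i = weight (List.lookup L (index i))
  g-injective : Injective _≡_ _≡_ g
  g-injective {i} {j} eq = Fin.inject≤-injective k≤|L| k≤|L| i j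
    (unique-lookup-injective unique (index i) (index j) (weight-injective _ _ eq))

singletons : ∀ n → List (Subset n)
singletons n = List.map ⁅_⁆ (List.allFin n)

singletons-unique : Unique (singletons n)
singletons-unique {n} = Unique.map⁺ ⁅⁆-injective (Unique.allFin⁺ n)

length-singletons : length (singletons n) ≡ n
length-singletons {n} = trans (length-map ⁅_⁆ (List.allFin n)) (length-tabulate id)

singletons-nonempty : ∀ {T : Subset n} → T ∈ singletons n → Nonempty T
singletons-nonempty T∈ with ∈-map⁻ ⁅_⁆ T∈
... | x , _ , refl = x , x∈⁅x⁆ x

Z₁-embedding-singletons : ∀ (H : Hypergraph n) f → (∀ {T} → Nonempty T → Isolating H f (weight T)) →
                          Z₁-Embedding n H f
Z₁-embedding-singletons H f isolating =
  Z₁-embedding H f (singletons _) singletons-unique (≤-reflexive (sym length-singletons))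
    λ T∈ → isolating (singletons-nonempty T∈) , singletons-nonempty T∈

-- Isolating weights built from the smallest edges

module Construction {n} (H : Hypergraph n) (f : Fin 2 → ℚ)
                    (0<a : 0ℚ ℚ.< f zero) (a<b : f zero ℚ.< f (suc zero))
                    {E₀} (E₀∈H : E₀ ∈ H) (minimal : ∀ {e} → e ∈ H → ∣ E₀ ∣ ≤ ∣ e ∣) where

  open TwoValueCosts f 0<a a<b

  Isolates : Subset n → Subset n → Set
  Isolates T = UniqueMinimiser H f (weight T)

  isolates⇒isolating : ∀ T {E} → Isolates T E → Isolating H f (weight T)
  isolates⇒isolating T = uniqueMinimiser⇒isolating {H = H} {f = f} {w = weight T}

  isolates-unique : ∀ T {E E′} → Isolates T E → Isolates T E′ → E ≡ E′
  isolates-unique T = uniqueMinimiser-unique {H = H} {f = f} {w = weight T}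

  isolates-empty : ∣ E₀ ∣ ≡ 0 → ∀ T → Isolates T E₀
  isolates-empty ∣E₀∣≡0 T = E₀∈H , λ {e} e∈H e≢E₀ →
    fw-weight-< T E₀ e (minimal e∈H) (∣E₀─T∣≤ e) (inj₁ (≤∧≢⇒< (minimal e∈H) (e≢E₀ ∘ e≡E₀ e∈H)))
    where
    ∣E₀─T∣≤ : ∀ e → ∣ E₀ ─ T ∣ ≤ ∣ e ─ T ∣
    ∣E₀─T∣≤ e = ≤-trans (∣p─q∣≤∣p∣ E₀ T) (subst (_≤ ∣ e ─ T ∣) (sym ∣E₀∣≡0) z≤n)
    e≡E₀ : ∀ {e} → e ∈ H → ∣ E₀ ∣ ≡ ∣ e ∣ → e ≡ E₀
    e≡E₀ {e} e∈H ∣E₀∣≡∣e∣ = ∣p─q∣≡0∧∣q∣≤∣p∣⇒p≡q e E₀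
      (n≤0⇒n≡0 (≤-trans (∣p─q∣≤∣p∣ e E₀) (≤-reflexive (trans (sym ∣E₀∣≡∣e∣) ∣E₀∣≡0)))) (minimal e∈H)

  K : List (Subset n)
  K = filter (λ e → ∣ e ∣ ℕ.≟ ∣ E₀ ∣) H

  ∈K⁺ : ∀ {E} → E ∈ H → ∣ E ∣ ≡ ∣ E₀ ∣ → E ∈ K
  ∈K⁺ = ∈-filter⁺ (λ e → ∣ e ∣ ℕ.≟ ∣ E₀ ∣)

  ∈K⁻ : ∀ {E} → E ∈ K → E ∈ H × ∣ E ∣ ≡ ∣ E₀ ∣
  ∈K⁻ = ∈-filter⁻ (λ e → ∣ e ∣ ℕ.≟ ∣ E₀ ∣)

  ∣K∣≤∣e∣ : ∀ {E e} → E ∈ K → e ∈ H → ∣ E ∣ ≤ ∣ e ∣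
  ∣K∣≤∣e∣ E∈K e∈H = subst (_≤ _) (sym (proj₂ (∈K⁻ E∈K))) (minimal e∈H)

  isolates-self : ∀ {E} → E ∈ K → Isolates E E
  isolates-self {E} E∈K = proj₁ (∈K⁻ E∈K) , λ {e} e∈H e≢E →
    fw-weight-< E E e (∣K∣≤∣e∣ E∈K e∈H) (subst (_≤ ∣ e ─ E ∣) (sym (∣p─p∣≡0 E)) z≤n)
      (inj₂ (subst (_< ∣ e ─ E ∣) (sym (∣p─p∣≡0 E))
        (n≢0⇒n>0 (λ ∣e─E∣≡0 → e≢E (∣p─q∣≡0∧∣q∣≤∣p∣⇒p≡q e E ∣e─E∣≡0 (∣K∣≤∣e∣ E∈K e∈H))))))

  NoRival : Subset n → Fin n → Set
  NoRival E z = ∀ y → y ≢ z → toggle (toggle E z) y ∉ K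

  noRival⇒distance≢1 : ∀ {E z e} → E ∈ K → NoRival E z → e ∈ H → e ≢ E → ∣ e ∣ ≡ ∣ E ∣ →
                       distance e (toggle E z) ≢ 1
  noRival⇒distance≢1 {E} {z} {e} E∈K noRival e∈H e≢E ∣e∣≡∣E∣ d≡1 with distance≡1⇒toggle e (toggle E z) d≡1
  ... | y , e≡ with y Fin.≟ z
  ...   | yes refl = e≢E (trans e≡ (toggle-involutive E z))
  ...   | no y≢z = noRival y y≢z (subst (_∈ K) e≡ (∈K⁺ e∈H (trans ∣e∣≡∣E∣ (proj₂ (∈K⁻ E∈K)))))

  isolates-toggle : ∀ {E z} → E ∈ K → NoRival E z → Isolates (toggle E z) E
  isolates-toggle {E} {z} E∈K noRival with z ∈ₛ? E
  ... | no z∉E = proj₁ (∈K⁻ E∈K) , λ {e} e∈H e≢E →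
    fw-weight-< T E e (∣K∣≤∣e∣ E∈K e∈H) (subst (_≤ ∣ e ─ T ∣) (sym ∣E─T∣≡0) z≤n) (strict e∈H e≢E)
    where
    T = toggle E z
    ∣E─T∣≡0 = proj₁ (toggle-∉ z∉E)
    strict : ∀ {e} → e ∈ H → e ≢ E → ∣ E ∣ < ∣ e ∣ ⊎ ∣ E ─ T ∣ < ∣ e ─ T ∣
    strict {e} e∈H e≢E with ∣ e ∣ ℕ.≟ ∣ E ∣ | ∣ e ─ T ∣ ℕ.≟ 0
    ... | no ∣e∣≢∣E∣ | _ = inj₁ (≤∧≢⇒< (∣K∣≤∣e∣ E∈K e∈H) (∣e∣≢∣E∣ ∘ sym))
    ... | yes _ | no ∣e─T∣≢0 = inj₂ (subst (_< ∣ e ─ T ∣) (sym ∣E─T∣≡0) (n≢0⇒n>0 ∣e─T∣≢0))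
    ... | yes ∣e∣≡∣E∣ | yes ∣e─T∣≡0 = contradiction
      (∣p─q∣≡0∧∣q∣≡1+∣p∣⇒distance≡1 e T ∣e─T∣≡0 (trans (proj₂ (toggle-∉ z∉E)) (cong suc (sym ∣e∣≡∣E∣))))
      (noRival⇒distance≢1 E∈K noRival e∈H e≢E ∣e∣≡∣E∣)
  ... | yes z∈E = proj₁ (∈K⁻ E∈K) , λ {e} e∈H e≢E →
    fw-weight-< T E e (∣K∣≤∣e∣ E∈K e∈H) (subst (_≤ ∣ e ─ T ∣) (sym ∣E─T∣≡1) (1≤∣e─T∣ e∈H)) (strict e∈H e≢E)
    where
    T = toggle E z
    ∣E─T∣≡1 = proj₁ (toggle-∈ z∈E)
    1≤∣e─T∣ : ∀ {e} → e ∈ H → 1 ≤ ∣ e ─ T ∣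
    1≤∣e─T∣ {e} e∈H = n≢0⇒n>0 λ ∣e─T∣≡0 →
      <⇒≱ (subst (_≤ ∣ e ∣) (proj₂ (toggle-∈ z∈E)) (∣K∣≤∣e∣ E∈K e∈H)) (∣p─q∣≡0⇒∣p∣≤∣q∣ e T ∣e─T∣≡0)
    strict : ∀ {e} → e ∈ H → e ≢ E → ∣ E ∣ < ∣ e ∣ ⊎ ∣ E ─ T ∣ < ∣ e ─ T ∣
    strict {e} e∈H e≢E with ∣ e ∣ ℕ.≟ ∣ E ∣ | ∣ e ─ T ∣ ℕ.≟ 1
    ... | no ∣e∣≢∣E∣ | _ = inj₁ (≤∧≢⇒< (∣K∣≤∣e∣ E∈K e∈H) (∣e∣≢∣E∣ ∘ sym))
    ... | yes _ | no ∣e─T∣≢1 = inj₂ (subst (_< ∣ e ─ T ∣) (sym ∣E─T∣≡1) (≤∧≢⇒< (1≤∣e─T∣ e∈H) (∣e─T∣≢1 ∘ sym)))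
    ... | yes ∣e∣≡∣E∣ | yes ∣e─T∣≡1 = contradiction
      (∣p─q∣≡1∧∣p∣≡1+∣q∣⇒distance≡1 e T ∣e─T∣≡1 (trans ∣e∣≡∣E∣ (proj₂ (toggle-∈ z∈E))))
      (noRival⇒distance≢1 E∈K noRival e∈H e≢E ∣e∣≡∣E∣)

  Private : Subset n → Fin n → Set
  Private E z = Nonempty (toggle E z) × NoRival E z

  private? : ∀ E z → Dec (Private E z)
  private? E z = nonempty? (toggle E z)
           ×-dec Fin.all? (λ y → ¬? (y Fin.≟ z) →-dec ¬? (toggle (toggle E z) y ∈? K))

  Covered : Fin n → Set
  Covered z = Any (λ E → Private E z) K

  covered? : ∀ z → Dec (Covered z)
  covered? z = Any.any? (λ E → private? E z) K

  rival : ∀ {E z} → ¬ Covered z → E ∈ K → Nonempty (toggle E z) →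
          ∃[ y ] (y ≢ z × toggle (toggle E z) y ∈ K)
  rival {E} {z} uncovered E∈K nonempty
    with Fin.any? (λ y → ¬? (y Fin.≟ z) ×-dec (toggle (toggle E z) y ∈? K))
  ... | yes r = r
  ... | no ¬r = contradiction (lose E∈K (nonempty , λ y y≢z u∈K → ¬r (y , y≢z , u∈K))) uncovered

  -- E₀ is a junk default: only covered coordinates are ever used
  chosen : Fin n → Subset n
  chosen z with covered? z
  ... | yes covered = proj₁ (find covered)
  ... | no _ = E₀

  chosen-private : ∀ {z} → Covered z → chosen z ∈ K × Private (chosen z) z
  chosen-private {z} covered with covered? z
  ... | yes covered′ = proj₂ (find covered′)
  ... | no uncovered = contradiction covered uncovered

  isolator : Fin n → Subset n
  isolator z = toggle (chosen z) z

  isolator-isolates : ∀ {z} → Covered z → Isolates (isolator z) (chosen z)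
  isolator-isolates covered =
    isolates-toggle (proj₁ (chosen-private covered)) (proj₂ (proj₂ (chosen-private covered)))

  isolator-injective : ∀ {z z′} → Covered z → Covered z′ → isolator z ≡ isolator z′ → z ≡ z′
  isolator-injective {z} {z′} covered covered′ eq =
    toggle-injective (chosen z) (trans eq (cong (λ E → toggle E z′) (sym same)))
    where
    same : chosen z ≡ chosen z′
    same = isolates-unique (isolator z) (isolator-isolates covered)
             (subst (λ T → Isolates T (chosen z′)) (sym eq) (isolator-isolates covered′))

  isolator∉K : ∀ {z} → Covered z → isolator z ∉ K
  isolator∉K {z} covered T∈K = toggle-≢ (chosen z) z
    (isolates-unique (isolator z) (isolates-self T∈K) (isolator-isolates covered))

  coveredCoordinates uncoveredCoordinates : List (Fin n)
  coveredCoordinates = filter covered? (List.allFin n)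
  uncoveredCoordinates = filter (¬? ∘ covered?) (List.allFin n)

  candidates : List (Subset n)
  candidates = List.map isolator coveredCoordinates ++ K

  candidates-unique : Unique H → Unique candidates
  candidates-unique uniqueH = Unique.++⁺
    (unique-map⁺ (All.all-filter covered? (List.allFin n)) isolator-injective
                 (Unique.filter⁺ covered? (Unique.allFin⁺ n)))
    (Unique.filter⁺ _ uniqueH) disjoint
    where
    disjoint : ∀ {T} → ¬ (T ∈ List.map isolator coveredCoordinates × T ∈ K)
    disjoint (T∈ , T∈K) with ∈-map⁻ isolator T∈
    ... | z , z∈ , refl = isolator∉K (proj₂ (∈-filter⁻ covered? {xs = List.allFin n} z∈)) T∈K

  candidates-good : 1 ≤ ∣ E₀ ∣ → ∀ {T} → T ∈ candidates → Isolating H f (weight T) × Nonempty T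
  candidates-good 1≤∣E₀∣ {T} T∈ with ∈-++⁻ (List.map isolator coveredCoordinates) T∈
  ... | inj₂ T∈K = isolates⇒isolating T (isolates-self T∈K) ,
                   ∣p∣≢0⇒nonempty (n>0⇒n≢0 (subst (1 ≤_) (sym (proj₂ (∈K⁻ T∈K))) 1≤∣E₀∣))
  ... | inj₁ T∈ with ∈-map⁻ isolator T∈
  ...   | z , z∈ , refl =
    isolates⇒isolating (isolator z) (isolator-isolates covered) , proj₁ (proj₂ (chosen-private covered))
    where
    covered : Covered z
    covered = proj₂ (∈-filter⁻ covered? {xs = List.allFin n} z∈)

  E₀∈K : E₀ ∈ K
  E₀∈K = ∈K⁺ E₀∈H refl

  singleton∈K : ∣ E₀ ∣ ≡ 1 → ∀ {z} → ¬ Covered z → ⁅ z ⁆ ∈ K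
  singleton∈K ∣E₀∣≡1 {z} uncovered with z ∈ₛ? E₀
  ... | yes z∈E₀ = subst (_∈ K) (∣p∣≡1⇒p≡⁅x⁆ z∈E₀ ∣E₀∣≡1) E₀∈K
  ... | no z∉E₀ with rival uncovered E₀∈K (z , ∈-toggle z∉E₀)
  ...   | y , y≢z , u∈K =
    subst (_∈ K) (∣p∣≡1⇒p≡⁅x⁆ (∈-toggle′ (y≢z ∘ sym) (∈-toggle z∉E₀)) (trans (proj₂ (∈K⁻ u∈K)) ∣E₀∣≡1))
          u∈K

  uncovered-bound-singleton : ∣ E₀ ∣ ≡ 1 → length uncoveredCoordinates ≤ length K
  uncovered-bound-singleton ∣E₀∣≡1 = subst (_≤ length K) (length-map ⁅_⁆ uncoveredCoordinates)
    (unique-⊆⇒length≤ (Unique.map⁺ ⁅⁆-injective (Unique.filter⁺ (¬? ∘ covered?) (Unique.allFin⁺ n)))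
                      singletons⊆K)
    where
    singletons⊆K : ∀ {s} → s ∈ List.map ⁅_⁆ uncoveredCoordinates → s ∈ K
    singletons⊆K s∈ with ∈-map⁻ ⁅_⁆ s∈
    ... | z , z∈ , refl = singleton∈K ∣E₀∣≡1 (proj₂ (∈-filter⁻ (¬? ∘ covered?) {xs = List.allFin n} z∈))

  uncovered-bound-dense : 2 ≤ ∣ E₀ ∣ → length uncoveredCoordinates ≤ length K
  uncovered-bound-dense 2≤∣E₀∣ =
    subst (_≤ length K) (∣tabulate∣≡length-filter (¬? ∘ covered?) id) (dense⇒∣β∣≤length E₀∈K dense)
    where
    β : Subset n
    β = tabulate (does ∘ ¬? ∘ covered?)
    uncovered : ∀ {z} → z ∈ₛ β → ¬ Covered z
    uncovered {z} z∈β with covered? z | trans (sym (lookup∘tabulate (does ∘ ¬? ∘ covered?) z)) ([]=⇒lookup z∈β)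
    ... | no ¬covered | _ = ¬covered
    dense : Dense β K
    dense {t} t∈K {z} z∈β =
      inj₂ (rival (uncovered z∈β) t∈K (toggle-nonempty z (subst (2 ≤_) (sym (proj₂ (∈K⁻ t∈K))) 2≤∣E₀∣)))

  uncovered-bound : 1 ≤ ∣ E₀ ∣ → length uncoveredCoordinates ≤ length K
  uncovered-bound 1≤∣E₀∣ with ∣ E₀ ∣ ℕ.≟ 1
  ... | yes ∣E₀∣≡1 = uncovered-bound-singleton ∣E₀∣≡1
  ... | no ∣E₀∣≢1 = uncovered-bound-dense (≤∧≢⇒< 1≤∣E₀∣ (∣E₀∣≢1 ∘ sym))

  candidates-length : 1 ≤ ∣ E₀ ∣ → n ≤ length candidates
  candidates-length 1≤∣E₀∣ = begin
    n
      ≡⟨ length-tabulate id ⟨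
    length (List.allFin n)
      ≡⟨ length-filter+length-filter¬ covered? (List.allFin n) ⟨
    length coveredCoordinates + length uncoveredCoordinates
      ≤⟨ +-monoʳ-≤ (length coveredCoordinates) (uncovered-bound 1≤∣E₀∣) ⟩
    length coveredCoordinates + length K
      ≡⟨ cong (_+ length K) (length-map isolator coveredCoordinates) ⟨
    length (List.map isolator coveredCoordinates) + length K
      ≡⟨ length-++ (List.map isolator coveredCoordinates) ⟨
    length candidates
      ∎
    where open ≤-Reasoning

  Z₁-embedding-n : Unique H → Z₁-Embedding n H f
  Z₁-embedding-n uniqueH with ∣ E₀ ∣ ℕ.≟ 0
  ... | yes ∣E₀∣≡0 = Z₁-embedding-singletons H f λ {T} _ → isolates⇒isolating T (isolates-empty ∣E₀∣≡0 T)
  ... | no ∣E₀∣≢0 = Z₁-embedding H f candidates (candidates-unique uniqueH)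
                      (candidates-length (n≢0⇒n>0 ∣E₀∣≢0)) (candidates-good (n≢0⇒n>0 ∣E₀∣≢0))

inclusionFree⇒unique : ∀ {H : Hypergraph n} → InclusionFree H → Unique H
inclusionFree⇒unique = AllPairs.map (λ {e} (e⊈e′ , _) e≡e′ → e⊈e′ (subst (e ⊆_) e≡e′ ⊆-refl))

smallest : ∀ (e : Subset n) H → ∃[ E₀ ] (E₀ ∈ e ∷ H × (∀ {e′} → e′ ∈ e ∷ H → ∣ E₀ ∣ ≤ ∣ e′ ∣))
smallest e H = argmin ∣_∣ e H , argmin-all ∣_∣ (here′ refl) (All.tabulate there′) , minimal
  where
  minimal : ∀ {e′} → e′ ∈ e ∷ H → ∣ argmin ∣_∣ e H ∣ ≤ ∣ e′ ∣
  minimal (here′ refl) = f[argmin]≤f[⊤] {f = ∣_∣} e H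
  minimal (there′ e′∈H) = All.lookup (f[argmin]≤f[xs] {f = ∣_∣} e H) e′∈H

-- The argument also covers n = 0.
corollary6 : ∀ (n : ℕ) → 1 ≤ n → Y₁-atLeast 2 n n
corollary6 n _ [] _ f _ _ = Z₁-embedding-singletons [] f (λ _ → inj₁ refl)
corollary6 n _ (e ∷ H) inclusionFree f increasing positive with smallest e H
... | E₀ , E₀∈H , minimal =
  Construction.Z₁-embedding-n (e ∷ H) f (positive zero) (increasing (s≤s z≤n)) E₀∈H minimal
    (inclusionFree⇒unique inclusionFree)
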